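{- If $D$ is a generalized skew diagram, then $\mathrm{MaxG}(D)\ge \mathrm{sf}(D)$.
   Context: A diagram is a finite set of cells at positions $(r,c)$ with $r,c$ positive integers ($r$ = row from the bottom, $c$ = column), at most one cell per position; each cell is either ordinary, written $(r,c)$, or a ghost cell, written $\langle r,c\rangle$. A position is empty if it contains no cell. K-Kohnert move at row $r$ of $D$: let the rightmost cell of row $r$ (ghost or not) lie in column $c$. The move does nothing if that cell is a ghost cell, or every position $(r',c)$ with $r'<r$ is occupied, or, letting $\hat r<r$ be maximal with $(\hat r,c)$ empty, some $(r^*,c)$ with $\hat r<r^*<r$ holds a ghost cell. Otherwise there are two choices: the Kohnert move moves the cell from $(r,c)$ to $(\hat r,c)$; the ghost move does the same and additionally places a ghost cell $\langle r,c\rangle$ at $(r,c)$. $KKD(D)$ is the set of $D$ and all diagrams obtained from $D$ by finite sequences of K-Kohnert moves; $\mathrm{MaxG}(D)$ is the maximum number of ghost cells in a diagram of $KKD(D)$. Snow diagram: for $D$ with no ghost cells, process rows from top to bottom; in each row mark the rightmost cell of that row with no already-marked cell above it in its column (if any); marked cells are dark clouds. Place a snowflake in each empty position strictly below a dark cloud in the same column; $\mathrm{sf}(D)$ is the number of snowflakes. Generalized skew diagram: a diagram $D$ with no ghost cells whose nonempty rows are $r_1<\dots<r_n$, such that, writing $c_i^+$ (resp. $c_i^-$) for the column of the rightmost (resp. leftmost) cell of row $r_i$: for each $i$, $(r_i,\tilde c)\in D$ for all $c_i^-<\tilde c<c_i^+$; and $c_i^+\le c_j^+$, $c_i^-\le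 c_j^-$ whenever $i<j$. -}

module Defs where

open import Data.Nat using (ℕ; zero; suc; _+_; _≤_; _<_; _≟_)
open import Data.Bool using (Bool; true; false; if_then_else_; _∧_; not)
open import Data.List using (List; []; _∷_)
open import Data.Bool.ListAction using (any)
open import Data.Maybe using (Maybe; just; nothing)
open import Data.Product using (_×_; _,_; ∃-syntax)
open import Data.Sum using (_⊎_)
open import Relation.Nullary using (¬_)
open import Relation.Nullary.Decidable using (⌊_⌋)
open import Relation.Binary.PropositionalEquality using (_≡_; _≢_)

-- A position (r , c) (r = row from the bottom, c = column)
-- holds nothing, an ordinary cell, or a ghost cell.  A diagram is a
-- function from positions to contents; rows/columns are 1-indexed, so
-- row 0 and column 0 must be empty; finiteness is expressed by a box
-- bound n (see Bounded).

data Content : Set where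
  empty ordinary ghost : Content

Diagram : Set
Diagram = ℕ → ℕ → Content

Bounded : ℕ → Diagram → Set
Bounded n D = ∀ r c → D r c ≢ empty → (1 ≤ r × r ≤ n) × (1 ≤ c × c ≤ n)

GhostFree : Diagram → Set
GhostFree D = ∀ r c → D r c ≢ ghost

isEmpty : Content → Bool
isEmpty empty = true
isEmpty _     = false

isOrdinary : Content → Bool
isOrdinary ordinary = true
isOrdinary _        = false

isGhost : Content → Bool
isGhost ghost = true
isGhost _     = false

RightmostCell : Diagram → ℕ → ℕ → Set
RightmostCell D r c = D r c ≢ empty × (∀ c' → c < c' → D r c' ≡ empty)

-- The Kohnert move
-- leaves (r , c) empty, the ghost move leaves a ghost there.
data KMove (D D' : Diagram) : Set where
  kmove : ∀ r c r̂ →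
    RightmostCell D r c →
    D r c ≡ ordinary →
    1 ≤ r̂ → r̂ < r →
    D r̂ c ≡ empty →
    (∀ r* → r̂ < r* → r* < r → D r* c ≡ ordinary) →
    (left : Content) → (left ≡ empty ⊎ left ≡ ghost) →
    D' r̂ c ≡ ordinary →
    D' r c ≡ left →
    (∀ i j → ¬ (i ≡ r̂ × j ≡ c) → ¬ (i ≡ r × j ≡ c) → D' i j ≡ D i j) →
    KMove D D'

data KKD (D : Diagram) : Diagram → Set where
  here : ∀ {D'} → (∀ i j → D' i j ≡ D i j) → KKD D D'
  step : ∀ {D' D''} → KKD D D' → KMove D' D'' → KKD D D''

sumTo : ℕ → (ℕ → ℕ) → ℕ
sumTo zero    f = 0
sumTo (suc k) f = sumTo k f + f (suc k)

boolToℕ : Bool → ℕ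
boolToℕ true  = 1
boolToℕ false = 0

ghostCount : ℕ → Diagram → ℕ
ghostCount n D = sumTo n λ r → sumTo n λ c → boolToℕ (isGhost (D r c))

rightmostSat : ℕ → (ℕ → Bool) → Maybe ℕ
rightmostSat zero    p = nothing
rightmostSat (suc k) p = if p (suc k) then just (suc k) else rightmostSat k p

memℕ : ℕ → List ℕ → Bool
memℕ x xs = any (λ y → ⌊ x ≟ y ⌋) xs

-- process rows k, k-1, …, 1 (top to bottom); `marked` are the columns
-- already containing a dark cloud (higher up).
cloudsAux : ℕ → Diagram → ℕ → List ℕ → List (ℕ × ℕ)
cloudsAux n D zero    marked = []
cloudsAux n D (suc k) marked
  with rightmostSat n (λ c → isOrdinary (D (suc k) c) ∧ not (memℕ c marked))
... | just c  = (suc k , c) ∷ cloudsAux n D k (c ∷ marked)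
... | nothing = cloudsAux n D k marked

darkClouds : ℕ → Diagram → List (ℕ × ℕ)
darkClouds n D = cloudsAux n D n []

cloudAbove : ℕ → Diagram → ℕ → ℕ → Bool
cloudAbove n D r c = any (λ { (r' , c') → ⌊ c ≟ c' ⌋ ∧ ⌊ suc r Data.Nat.≤? r' ⌋ }) (darkClouds n D)
  where import Data.Nat

sf : ℕ → Diagram → ℕ
sf n D = sumTo n λ r → sumTo n λ c → boolToℕ (isEmpty (D r c) ∧ cloudAbove n D r c)

IsRightmost : Diagram → ℕ → ℕ → Set
IsRightmost D r c = D r c ≡ ordinary × (∀ c' → c < c' → D r c' ≡ empty)

IsLeftmost : Diagram → ℕ → ℕ → Set
IsLeftmost D r c = D r c ≡ ordinary × (∀ c' → c' < c → D r c' ≡ empty)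

record GeneralizedSkew (D : Diagram) : Set where
  field
    ghostFree : GhostFree D
    contiguous : ∀ r c⁻ c⁺ c → IsLeftmost D r c⁻ → IsRightmost D r c⁺ →
                 c⁻ < c → c < c⁺ → D r c ≡ ordinary
    rightMono : ∀ r r' c c' → r < r' → IsRightmost D r c → IsRightmost D r' c' → c ≤ c'
    leftMono  : ∀ r r' c c' → r < r' → IsLeftmost D r c → IsLeftmost D r' c' → c ≤ c'

-- The dark clouds (t₁ , B₁), (t₂ , B₂), … of a generalized skew diagram go strictly down and to
-- the left, and sf(D) counts, for each cloud (t , B), the holes of column B below row t.  The
-- clouds are processed from the lowest one up.  For the cloud (t , B), the cells of row t right
-- of B are first pushed, from right to left, down to the lowest hole of their column by Kohnert
-- moves; then (t , B) is the rightmost cell of its row, and a chain of ghost moves slides it down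
-- to the lowest hole of column B, leaving a ghost at t and in every hole it passes: as many
-- ghosts as column B had holes below t.  Skewness makes every move legal: the rows of the holes
-- passed over are empty to the right, because further right columns have at least as many holes
-- at every height, an invariant that survives the pushes.

module Submission where

open import Data.Bool using (Bool; true; false; _∧_; not)
open import Data.Bool.ListAction using (any)
open import Data.Bool.Properties using (∧-zeroʳ; ∧-identityʳ)
open import Data.Empty using (⊥-elim)
open import Data.List using (List; []; _∷_; map)
open import Data.Maybe using (just; nothing)
open import Data.Nat using (ℕ; zero; suc; _+_; _≤_; _<_; _≟_; _≤?_; _<?_; z≤n; s≤s)
open import Data.Nat.Induction using (<-rec)
open import Data.Nat.ListAction using (sum)
open import Data.Nat.Properties
open import Algebra.Properties.CommutativeSemigroup +-commutativeSemigroup using (interchange)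
open import Data.Product using (Σ; ∃; ∃-syntax; _×_; _,_; proj₁; proj₂)
open import Data.Sum using (_⊎_; inj₁; inj₂; [_,_]′)
open import Data.Unit using (⊤; tt)
open import Function using (_∘_)
open import Relation.Binary using (Tri; tri<; tri≈; tri>)
open import Relation.Binary.Definitions using (DecidableEquality)
open import Relation.Binary.PropositionalEquality
open import Relation.Nullary using (Dec; yes; no; ¬_)
open import Relation.Nullary.Decidable
  using (⌊_⌋; _×-dec_; ¬?; decidable-stable; dec-true; dec-false; isYes≗does)
open import Relation.Unary using (Decidable)

open import Defs

_≟C_ : DecidableEquality Content
empty    ≟C empty    = yes refl
ordinary ≟C ordinary = yes refl
ghost    ≟C ghost    = yes refl
empty    ≟C ordinary = no λ ()
empty    ≟C ghost    = no λ ()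
ordinary ≟C empty    = no λ ()
ordinary ≟C ghost    = no λ ()
ghost    ≟C empty    = no λ ()
ghost    ≟C ordinary = no λ ()

≡ordinary⇒≢empty : ∀ {x} → x ≡ ordinary → x ≢ empty
≡ordinary⇒≢empty refl ()

≢empty∧≢ghost⇒≡ordinary : ∀ {x} → x ≢ empty → x ≢ ghost → x ≡ ordinary
≢empty∧≢ghost⇒≡ordinary {empty}    x≢e _   = ⊥-elim (x≢e refl)
≢empty∧≢ghost⇒≡ordinary {ordinary} _   _   = refl
≢empty∧≢ghost⇒≡ordinary {ghost}    _   x≢g = ⊥-elim (x≢g refl)

⌊⌋-true : ∀ {A : Set} (a? : Dec A) → A → ⌊ a? ⌋ ≡ true
⌊⌋-true a? a = trans (isYes≗does a?) (dec-true a? a)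

⌊⌋-false : ∀ {A : Set} (a? : Dec A) → ¬ A → ⌊ a? ⌋ ≡ false
⌊⌋-false a? ¬a = trans (isYes≗does a?) (dec-false a? ¬a)

module _ {P : ℕ → Set} (P? : Decidable P) where

  Least : ℕ → ℕ → Set
  Least m a = a ≤ m × P a × (∀ {j} → j < a → ¬ P j)

  private
    least-or-none : ∀ m → (∀ {j} → j ≤ m → ¬ P j) ⊎ ∃[ a ] Least m a
    least-or-none zero with P? zero
    ... | yes p = inj₂ (zero , z≤n , p , λ ())
    ... | no ¬p = inj₁ λ { z≤n → ¬p }
    least-or-none (suc m) with least-or-none m
    ... | inj₂ (a , a≤m , pa , below) = inj₂ (a , m≤n⇒m≤1+n a≤m , pa , below)
    ... | inj₁ none with P? (suc m)
    ...   | yes p = inj₂ (suc m , ≤-refl , p , λ j<sm → none (m<1+n⇒m≤n j<sm))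
    ...   | no ¬p = inj₁ λ {j} j≤sm →
      [ (λ j<sm → none (m<1+n⇒m≤n j<sm)) , (λ { refl → ¬p }) ]′ (m≤n⇒m<n∨m≡n j≤sm)

  least : ∀ {m} → P m → ∃[ a ] Least m a
  least {m} pm with least-or-none m
  ... | inj₁ none = ⊥-elim (none ≤-refl pm)
  ... | inj₂ found = found

  greatest : ∀ {m} N → (∀ {j} → N < j → ¬ P j) → P m →
             ∃[ b ] m ≤ b × P b × (∀ {j} → b < j → ¬ P j)
  greatest {m} N above pm with P? N
  ... | yes pN = N , ≮⇒≥ (λ N<m → above N<m pm) , pN , above
  greatest {m} zero above pm | no ¬pN =
    ⊥-elim (¬pN (subst P (n≤0⇒n≡0 (≮⇒≥ λ 0<m → above 0<m pm)) pm))
  greatest {m} (suc N) above pm | no ¬pN = greatest N above′ pm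
    where
      above′ : ∀ {j} → N < j → ¬ P j
      above′ {j} N<j with m≤n⇒m<n∨m≡n N<j
      ... | inj₁ sN<j = above sN<j
      ... | inj₂ refl = ¬pN

sumTo-cong : ∀ {f g} n → (∀ {i} → 1 ≤ i → i ≤ n → f i ≡ g i) → sumTo n f ≡ sumTo n g
sumTo-cong zero    eq = refl
sumTo-cong (suc n) eq =
  cong₂ _+_ (sumTo-cong n λ 1≤i i≤n → eq 1≤i (m≤n⇒m≤1+n i≤n)) (eq (s≤s z≤n) ≤-refl)

sumTo-mono : ∀ {f g} n → (∀ {i} → 1 ≤ i → i ≤ n → f i ≤ g i) → sumTo n f ≤ sumTo n g
sumTo-mono zero    le = ≤-refl
sumTo-mono (suc n) le =
  +-mono-≤ (sumTo-mono n λ 1≤i i≤n → le 1≤i (m≤n⇒m≤1+n i≤n)) (le (s≤s z≤n) ≤-refl)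

sumTo-zero : ∀ {f} n → (∀ {i} → 1 ≤ i → i ≤ n → f i ≡ 0) → sumTo n f ≡ 0
sumTo-zero zero    eq = refl
sumTo-zero (suc n) eq =
  cong₂ _+_ (sumTo-zero n λ 1≤i i≤n → eq 1≤i (m≤n⇒m≤1+n i≤n)) (eq (s≤s z≤n) ≤-refl)

sumTo-single : ∀ {f z} n → 1 ≤ z → z ≤ n → (∀ {i} → i ≢ z → f i ≡ 0) → sumTo n f ≡ f z
sumTo-single {f} zero 1≤z z≤0 _ = ⊥-elim (<-irrefl refl (≤-trans 1≤z z≤0))
sumTo-single {f} (suc n) 1≤z z≤1+n others with m≤n⇒m<n∨m≡n z≤1+n
... | inj₂ refl = cong (_+ f (suc n)) (sumTo-zero n λ _ i≤n → others (<⇒≢ (s≤s i≤n)))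
... | inj₁ z<1+n = begin
  sumTo n f + f (suc n) ≡⟨ cong₂ _+_ (sumTo-single n 1≤z (m<1+n⇒m≤n z<1+n) others)
                                     (others (>⇒≢ z<1+n)) ⟩
  f _ + 0               ≡⟨ +-identityʳ _ ⟩
  f _                   ∎
  where open ≡-Reasoning

sumTo-+ : ∀ {f g} n → sumTo n (λ i → f i + g i) ≡ sumTo n f + sumTo n g
sumTo-+ zero = refl
sumTo-+ {f} {g} (suc n) = begin
  sumTo n (λ i → f i + g i) + (f (suc n) + g (suc n)) ≡⟨ cong (_+ (f (suc n) + g (suc n))) (sumTo-+ n) ⟩
  sumTo n f + sumTo n g + (f (suc n) + g (suc n))     ≡⟨ interchange (sumTo n f) (sumTo n g) _ _ ⟩
  sumTo n f + f (suc n) + (sumTo n g + g (suc n))     ∎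
  where open ≡-Reasoning

sumTo-swap : ∀ {f : ℕ → ℕ → ℕ} n m →
             sumTo n (λ r → sumTo m (f r)) ≡ sumTo m (λ c → sumTo n (λ r → f r c))
sumTo-swap zero    m = sym (sumTo-zero m λ _ _ → refl)
sumTo-swap {f} (suc n) m = trans (cong (_+ sumTo m (f (suc n))) (sumTo-swap n m)) (sym (sumTo-+ m))

sumTo-≤-bound : ∀ {f} {a b} → a ≤ b → sumTo a f ≤ sumTo b f
sumTo-≤-bound {f} {a} {zero} a≤0 rewrite n≤0⇒n≡0 a≤0 = ≤-refl
sumTo-≤-bound {f} {a} {suc b} a≤1+b with m≤n⇒m<n∨m≡n a≤1+b
... | inj₂ refl = ≤-refl
... | inj₁ a<1+b = ≤-trans (sumTo-≤-bound (m<1+n⇒m≤n a<1+b)) (m≤m+n _ _)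

sumTo-extend : ∀ {f g} {a} b → sumTo a f ≡ sumTo a g → (∀ {i} → a < i → i ≤ b → f i ≡ g i) →
               a ≤ b → sumTo b f ≡ sumTo b g
sumTo-extend {a = a} zero eq _ a≤0 rewrite n≤0⇒n≡0 a≤0 = eq
sumTo-extend (suc b) eq same a≤1+b with m≤n⇒m<n∨m≡n a≤1+b
... | inj₂ refl = eq
... | inj₁ a<1+b =
  cong₂ _+_ (sumTo-extend b eq (λ a<i i≤b → same a<i (m≤n⇒m≤1+n i≤b)) (m<1+n⇒m≤n a<1+b)) (same a<1+b ≤-refl)

sumTo-restrict : ∀ {f g} {k} n → k ≤ n →
                 (∀ {i} → i ≤ k → g i ≡ f i) → (∀ {i} → k < i → g i ≡ 0) → sumTo n g ≡ sumTo k f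
sumTo-restrict {k = k} zero k≤0 inside _ rewrite n≤0⇒n≡0 k≤0 = refl
sumTo-restrict {f} {g} {k} (suc n) k≤1+n inside outside with m≤n⇒m<n∨m≡n k≤1+n
... | inj₂ refl = sumTo-cong (suc n) λ _ i≤1+n → inside i≤1+n
... | inj₁ k<1+n = begin
  sumTo n g + g (suc n) ≡⟨ cong₂ _+_ (sumTo-restrict n (m<1+n⇒m≤n k<1+n) inside outside) (outside k<1+n) ⟩
  sumTo k f + 0         ≡⟨ +-identityʳ _ ⟩
  sumTo k f             ∎
  where open ≡-Reasoning

sumTo-positive : ∀ {f} n → 1 ≤ sumTo n f → ∃[ i ] 1 ≤ i × i ≤ n × 1 ≤ f i
sumTo-positive zero ()
sumTo-positive {f} (suc n) pos with f (suc n) in eq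
... | suc _ = suc n , s≤s z≤n , ≤-refl , subst (1 ≤_) (sym eq) (s≤s z≤n)
... | zero with sumTo-positive n (subst (1 ≤_) (+-identityʳ _) pos)
...   | i , 1≤i , i≤n , fi = i , 1≤i , m≤n⇒m≤1+n i≤n , fi

term≤sumTo : ∀ {f i} n → 1 ≤ i → i ≤ n → f i ≤ sumTo n f
term≤sumTo zero 1≤i i≤0 = ⊥-elim (<-irrefl refl (≤-trans 1≤i i≤0))
term≤sumTo {f} (suc n) 1≤i i≤1+n with m≤n⇒m<n∨m≡n i≤1+n
... | inj₂ refl = m≤n+m _ _
... | inj₁ i<1+n = ≤-trans (term≤sumTo n 1≤i (m<1+n⇒m≤n i<1+n)) (m≤m+n _ _)

Column : Set
Column = ℕ → Content

column : Diagram → ℕ → Column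
column D c i = D i c

replaceColumn : Diagram → ℕ → Column → Diagram
replaceColumn D c u i j with j ≟ c
... | yes _ = u i
... | no  _ = D i j

replaceColumn-same : ∀ D c u i → replaceColumn D c u i c ≡ u i
replaceColumn-same D c u i with c ≟ c
... | yes _   = refl
... | no c≢c = ⊥-elim (c≢c refl)

replaceColumn-other : ∀ D {c} u i {j} → j ≢ c → replaceColumn D c u i j ≡ D i j
replaceColumn-other D {c} u i {j} j≢c with j ≟ c
... | yes j≡c = ⊥-elim (j≢c j≡c)
... | no  _   = refl

#empty : Content → ℕ
#empty x = boolToℕ (isEmpty x)

#ghost : Content → ℕ
#ghost x = boolToℕ (isGhost x)

holes : Column → ℕ → ℕ
holes u h = sumTo h λ i → #empty (u i)

ghosts : Column → ℕ → ℕ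
ghosts u h = sumTo h λ i → #ghost (u i)

holes-cong : ∀ {u v} h → (∀ i → u i ≡ v i) → holes u h ≡ holes v h
holes-cong h u≗v = sumTo-cong h λ {i} _ _ → cong #empty (u≗v i)

ghosts-cong : ∀ {u v} h → (∀ i → u i ≡ v i) → ghosts u h ≡ ghosts v h
ghosts-cong h u≗v = sumTo-cong h λ {i} _ _ → cong #ghost (u≗v i)

#empty-≡1 : ∀ {x} → x ≡ empty → #empty x ≡ 1
#empty-≡1 refl = refl

#empty-≡0 : ∀ {x} → x ≢ empty → #empty x ≡ 0
#empty-≡0 {empty}    x≢e = ⊥-elim (x≢e refl)
#empty-≡0 {ordinary} _   = refl
#empty-≡0 {ghost}    _   = refl

#empty-positive : ∀ x → 1 ≤ #empty x → x ≡ empty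
#empty-positive empty _ = refl

hole⇒holes-positive : ∀ {u y} h → 1 ≤ y → y ≤ h → u y ≡ empty → 1 ≤ holes u h
hole⇒holes-positive {u} h 1≤y y≤h uy = subst (_≤ holes u h) (#empty-≡1 uy) (term≤sumTo h 1≤y y≤h)

holes-positive⇒hole : ∀ {u} h → 1 ≤ holes u h → ∃[ y ] 1 ≤ y × y ≤ h × u y ≡ empty
holes-positive⇒hole {u} h pos with sumTo-positive h pos
... | y , 1≤y , y≤h , count = y , 1≤y , y≤h , #empty-positive (u y) count

holes-mono : ∀ {u v} h → (∀ {y} → 1 ≤ y → y ≤ h → v y ≢ empty → u y ≢ empty) →
             holes u h ≤ holes v h
holes-mono {u} {v} h filled = sumTo-mono h count≤
  where
    count≤ : ∀ {y} → 1 ≤ y → y ≤ h → #empty (u y) ≤ #empty (v y)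
    count≤ {y} 1≤y y≤h with v y ≟C empty
    ... | yes vy = subst (#empty (u y) ≤_) (sym (#empty-≡1 vy)) (#empty≤1 (u y))
      where
        #empty≤1 : ∀ x → #empty x ≤ 1
        #empty≤1 empty    = ≤-refl
        #empty≤1 ordinary = z≤n
        #empty≤1 ghost    = z≤n
    ... | no vy≢e = ≤-reflexive (trans (#empty-≡0 (filled 1≤y y≤h vy≢e)) (sym (#empty-≡0 vy≢e)))

LowestHole : Column → ℕ → Set
LowestHole u z = 1 ≤ z × u z ≡ empty × (∀ {y} → 1 ≤ y → y < z → u y ≢ empty)

lowestHole : ∀ {u} h → 1 ≤ holes u h → ∃[ z ] z ≤ h × LowestHole u z
lowestHole {u} h pos with holes-positive⇒hole h pos
... | y , 1≤y , y≤h , uy with least (λ i → (1 ≤? i) ×-dec (u i ≟C empty)) (1≤y , uy)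
...   | z , z≤y , (1≤z , uz) , below =
  z , ≤-trans z≤y y≤h , 1≤z , uz , λ 1≤i i<z ui → below i<z (1≤i , ui)

highestHoleBelow : ∀ {u : Column} {z t} → u z ≡ empty → z < t →
                   ∃[ h ] z ≤ h × h < t × u h ≡ empty × (∀ {y} → h < y → y < t → u y ≢ empty)
highestHoleBelow {u} {z} {t} uz z<t
  with greatest {λ y → y < t × u y ≡ empty} (λ y → (y <? t) ×-dec (u y ≟C empty)) t
                (λ t<y (y<t , _) → <-asym t<y y<t) (z<t , uz)
... | h , z≤h , (h<t , uh) , highest = h , z≤h , h<t , uh , λ h<y y<t uy → highest h<y (y<t , uy)

lowestHole-≤ : ∀ {u z} k → LowestHole u z → 1 ≤ holes u k → z ≤ k
lowestHole-≤ k (_ , _ , below) pos with holes-positive⇒hole k pos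
... | y , 1≤y , y≤k , uy = ≤-trans (≮⇒≥ λ y<z → below 1≤y y<z uy) y≤k

-- Sliding the cell at height t of a column down to the hole z

fillWith : Content → Content → Content
fillWith l empty = l
fillWith _ x     = x

fillWith-empty : ∀ x → fillWith empty x ≡ x
fillWith-empty empty    = refl
fillWith-empty ordinary = refl
fillWith-empty ghost    = refl

fillWith-nonempty : ∀ {l x} → x ≢ empty → fillWith l x ≡ x
fillWith-nonempty {x = empty}    x≢e = ⊥-elim (x≢e refl)
fillWith-nonempty {x = ordinary} _   = refl
fillWith-nonempty {x = ghost}    _   = refl

Comparison : ℕ → ℕ → Set
Comparison m n = Tri (m < n) (m ≡ n) (n < m)

-- The content of position i after the cell at t has moved down to z,
-- leaving l at t and in every hole strictly between; x is its content before.
slideAt : ∀ {i z t} → Comparison i z → Comparison i t → Content → Content → Content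
slideAt (tri< _ _ _) _            l x = x
slideAt (tri≈ _ _ _) _            l x = ordinary
slideAt (tri> _ _ _) (tri< _ _ _) l x = fillWith l x
slideAt (tri> _ _ _) (tri≈ _ _ _) l x = l
slideAt (tri> _ _ _) (tri> _ _ _) l x = x

-- Opaque, so that the lemmas below are its interface and its arguments can
-- be inferred by unification.
opaque
  slide : Column → (z t : ℕ) → Content → Column
  slide u z t l i = slideAt (<-cmp i z) (<-cmp i t) l (u i)

opaque
  unfolding slide

  slide-cong : ∀ {u v z t l i} → u i ≡ v i → slide u z t l i ≡ slide v z t l i
  slide-cong {z = z} {t} {l} {i} = cong (slideAt (<-cmp i z) (<-cmp i t) l)

module _ {u : Column} {z t : ℕ} {l : Content} where
  opaque
    unfolding slide

    slide-below : ∀ {i} → i < z → slide u z t l i ≡ u i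
    slide-below {i} i<z = below (<-cmp i z)
      where
        below : (cz : Comparison i z) → slideAt cz (<-cmp i t) l (u i) ≡ u i
        below (tri< _ _ _)   = refl
        below (tri≈ _ i≡z _) = ⊥-elim (<⇒≢ i<z i≡z)
        below (tri> _ _ z<i) = ⊥-elim (<-asym i<z z<i)

    slide-bottom : slide u z t l z ≡ ordinary
    slide-bottom = bottom (<-cmp z z)
      where
        bottom : (cz : Comparison z z) → slideAt cz (<-cmp z t) l (u z) ≡ ordinary
        bottom (tri< z<z _ _) = ⊥-elim (<-irrefl refl z<z)
        bottom (tri≈ _ _ _)   = refl
        bottom (tri> _ _ z<z) = ⊥-elim (<-irrefl refl z<z)

    slide-between : ∀ {i} → z < i → i < t → slide u z t l i ≡ fillWith l (u i)
    slide-between {i} z<i i<t = between (<-cmp i z) (<-cmp i t)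
      where
        between : (cz : Comparison i z) (ct : Comparison i t) → slideAt cz ct l (u i) ≡ fillWith l (u i)
        between (tri< i<z _ _) _              = ⊥-elim (<-asym i<z z<i)
        between (tri≈ _ i≡z _) _              = ⊥-elim (>⇒≢ z<i i≡z)
        between (tri> _ _ _)   (tri< _ _ _)   = refl
        between (tri> _ _ _)   (tri≈ _ i≡t _) = ⊥-elim (<⇒≢ i<t i≡t)
        between (tri> _ _ _)   (tri> _ _ t<i) = ⊥-elim (<-asym i<t t<i)

    slide-top : z < t → slide u z t l t ≡ l
    slide-top z<t = top (<-cmp t z) (<-cmp t t)
      where
        top : (cz : Comparison t z) (ct : Comparison t t) → slideAt cz ct l (u t) ≡ l
        top (tri< t<z _ _) _              = ⊥-elim (<-asym t<z z<t)
        top (tri≈ _ t≡z _) _              = ⊥-elim (>⇒≢ z<t t≡z)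
        top (tri> _ _ _)   (tri< t<t _ _) = ⊥-elim (<-irrefl refl t<t)
        top (tri> _ _ _)   (tri≈ _ _ _)   = refl
        top (tri> _ _ _)   (tri> _ _ t<t) = ⊥-elim (<-irrefl refl t<t)

    slide-above : ∀ {i} → z < t → t < i → slide u z t l i ≡ u i
    slide-above {i} z<t t<i = above (<-cmp i z) (<-cmp i t)
      where
        above : (cz : Comparison i z) (ct : Comparison i t) → slideAt cz ct l (u i) ≡ u i
        above (tri< i<z _ _) _              = ⊥-elim (<-asym i<z (<-trans z<t t<i))
        above (tri≈ _ i≡z _) _              = ⊥-elim (>⇒≢ (<-trans z<t t<i) i≡z)
        above (tri> _ _ _)   (tri< i<t _ _) = ⊥-elim (<-asym i<t t<i)
        above (tri> _ _ _)   (tri≈ _ i≡t _) = ⊥-elim (>⇒≢ t<i i≡t)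
        above (tri> _ _ _)   (tri> _ _ _)   = refl

    slide-outside : ∀ {i} → i ≢ z → i ≢ t → (z < i → i < t → fillWith l (u i) ≡ u i) →
                    slide u z t l i ≡ u i
    slide-outside {i} i≢z i≢t unfilled = outside (<-cmp i z) (<-cmp i t)
      where
        outside : (cz : Comparison i z) (ct : Comparison i t) → slideAt cz ct l (u i) ≡ u i
        outside (tri< _ _ _)   _              = refl
        outside (tri≈ _ i≡z _) _              = ⊥-elim (i≢z i≡z)
        outside (tri> _ _ z<i) (tri< i<t _ _) = unfilled z<i i<t
        outside (tri> _ _ _)   (tri≈ _ i≡t _) = ⊥-elim (i≢t i≡t)
        outside (tri> _ _ _)   (tri> _ _ _)   = refl

    slide-above-bottom : ∀ {z′ i} → z < i → z′ < i → slide u z t l i ≡ slide u z′ t l i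
    slide-above-bottom {z′} {i} z<i z′<i = above-both (<-cmp i z) (<-cmp i z′) (<-cmp i t)
      where
        above-both : (cz : Comparison i z) (cz′ : Comparison i z′) (ct : Comparison i t) →
                     slideAt cz ct l (u i) ≡ slideAt cz′ ct l (u i)
        above-both (tri< i<z _ _) _               _ = ⊥-elim (<-asym i<z z<i)
        above-both (tri≈ _ i≡z _) _               _ = ⊥-elim (>⇒≢ z<i i≡z)
        above-both (tri> _ _ _)   (tri< i<z′ _ _) _ = ⊥-elim (<-asym i<z′ z′<i)
        above-both (tri> _ _ _)   (tri≈ _ i≡z′ _) _ = ⊥-elim (>⇒≢ z′<i i≡z′)
        above-both (tri> _ _ _)   (tri> _ _ _)    (tri< _ _ _) = refl
        above-both (tri> _ _ _)   (tri> _ _ _)    (tri≈ _ _ _) = refl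
        above-both (tri> _ _ _)   (tri> _ _ _)    (tri> _ _ _) = refl

    slide-below-top : ∀ {t′ i} → i < t → i < t′ → slide u z t l i ≡ slide u z t′ l i
    slide-below-top {t′} {i} i<t i<t′ = below-both (<-cmp i z) (<-cmp i t) (<-cmp i t′)
      where
        below-both : (cz : Comparison i z) (ct : Comparison i t) (ct′ : Comparison i t′) →
                     slideAt cz ct l (u i) ≡ slideAt cz ct′ l (u i)
        below-both (tri< _ _ _) _ _                           = refl
        below-both (tri≈ _ _ _) _ _                           = refl
        below-both (tri> _ _ _) (tri< _ _ _)   (tri< _ _ _)    = refl
        below-both (tri> _ _ _) (tri≈ _ i≡t _) _              = ⊥-elim (<⇒≢ i<t i≡t)
        below-both (tri> _ _ _) (tri> _ _ t<i) _              = ⊥-elim (<-asym i<t t<i)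
        below-both (tri> _ _ _) (tri< _ _ _)   (tri≈ _ i≡t′ _) = ⊥-elim (<⇒≢ i<t′ i≡t′)
        below-both (tri> _ _ _) (tri< _ _ _)   (tri> _ _ t′<i) = ⊥-elim (<-asym i<t′ t′<i)

slide-empty-elsewhere : ∀ {u z t i} → i ≢ z → i ≢ t → slide u z t empty i ≡ u i
slide-empty-elsewhere {u} {i = i} i≢z i≢t = slide-outside i≢z i≢t λ _ _ → fillWith-empty (u i)

slide-slide : ∀ {u z h t l} → z < h → h < t → u h ≡ empty →
              ∀ i → slide (slide u h t l) z h l i ≡ slide u z t l i
slide-slide {u} {z} {h} {t} {l} z<h h<t uh≡e i = compare (<-cmp i h)
  where
    open ≡-Reasoning
    compare : Comparison i h → slide (slide u h t l) z h l i ≡ slide u z t l i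
    compare (tri< i<h _ _) = begin
      slide (slide u h t l) z h l i ≡⟨ slide-cong (slide-below i<h) ⟩
      slide u z h l i               ≡⟨ slide-below-top i<h (<-trans i<h h<t) ⟩
      slide u z t l i               ∎
    compare (tri≈ _ refl _) = begin
      slide (slide u h t l) z h l h ≡⟨ slide-top z<h ⟩
      l                             ≡⟨ cong (fillWith l) (sym uh≡e) ⟩
      fillWith l (u h)              ≡⟨ slide-between z<h h<t ⟨
      slide u z t l h               ∎
    compare (tri> _ _ h<i) = begin
      slide (slide u h t l) z h l i ≡⟨ slide-above z<h h<i ⟩
      slide u h t l i               ≡⟨ slide-above-bottom h<i (<-trans z<h h<i) ⟩
      slide u z t l i               ∎

_≈D_ : Diagram → Diagram → Set
E ≈D F = ∀ i j → E i j ≡ F i j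

KMove-respʳ : ∀ {E F F′} → KMove E F → F′ ≈D F → KMove E F′
KMove-respʳ (kmove r c r̂ rightmost ord 1≤r̂ r̂<r empty-r̂ between left left-kind new-r̂ new-r rest)
            F′≈F =
  kmove r c r̂ rightmost ord 1≤r̂ r̂<r empty-r̂ between left left-kind
    (trans (F′≈F r̂ c) new-r̂) (trans (F′≈F r c) new-r)
    (λ i j ≢r̂ ≢r → trans (F′≈F i j) (rest i j ≢r̂ ≢r))

KKD-respʳ : ∀ {E F F′} → KKD E F → F′ ≈D F → KKD E F′
KKD-respʳ (here F≈E)  F′≈F = here λ i j → trans (F′≈F i j) (F≈E i j)
KKD-respʳ (step k m) F′≈F = step k (KMove-respʳ m F′≈F)

KKD-refl : ∀ {E} → KKD E E
KKD-refl = here λ _ _ → refl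

KKD-trans : ∀ {E F G} → KKD E F → KKD F G → KKD E G
KKD-trans k (here G≈F)  = KKD-respʳ k G≈F
KKD-trans k (step k′ m) = step (KKD-trans k k′) m

≈D-by-column : ∀ {E F} c → (∀ i → E i c ≡ F i c) → (∀ i {j} → j ≢ c → E i j ≡ F i j) →
               E ≈D F
≈D-by-column c on-c off-c i j with j ≟ c
... | yes refl = on-c i
... | no  j≢c  = off-c i j≢c

slideColumn : Diagram → (c z t : ℕ) → Content → Diagram
slideColumn E c z t l = replaceColumn E c (slide (column E c) z t l)

slideColumn-same : ∀ E c {z t l} i → slideColumn E c z t l i c ≡ slide (column E c) z t l i
slideColumn-same E c i = replaceColumn-same E c _ i

slideColumn-other : ∀ E {c z t l} i {j} → j ≢ c → slideColumn E c z t l i j ≡ E i j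
slideColumn-other E i j≢c = replaceColumn-other E _ i j≢c

slide-move : ∀ {E c h t l} → l ≡ empty ⊎ l ≡ ghost → 1 ≤ h → h < t →
             E t c ≡ ordinary → (∀ {c′} → c < c′ → E t c′ ≡ empty) → E h c ≡ empty →
             (∀ {y} → h < y → y < t → E y c ≡ ordinary) → KMove E (slideColumn E c h t l)
slide-move {E} {c} {h} {t} {l} l-kind 1≤h h<t top-ord top-rightmost hole between =
  kmove t c h (≡ordinary⇒≢empty top-ord , λ _ → top-rightmost)
    top-ord 1≤h h<t hole (λ _ → between) l l-kind
    (trans (slideColumn-same E c h) slide-bottom)
    (trans (slideColumn-same E c t) (slide-top h<t))
    unchanged
  where
    unchanged : ∀ i j → ¬ (i ≡ h × j ≡ c) → ¬ (i ≡ t × j ≡ c) →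
                slideColumn E c h t l i j ≡ E i j
    unchanged i j ≢h ≢t with j ≟ c
    ... | no  _    = refl
    ... | yes refl = slide-outside (λ i≡h → ≢h (i≡h , refl)) (λ i≡t → ≢t (i≡t , refl))
                       (λ h<i i<t → fillWith-nonempty (≡ordinary⇒≢empty (between h<i i<t)))

record SlideCondition (E : Diagram) (c z t : ℕ) : Set where
  field
    1≤z                       : 1 ≤ z
    z<t                       : z < t
    top-ordinary              : E t c ≡ ordinary
    top-rightmost             : ∀ {c′} → c < c′ → E t c′ ≡ empty
    bottom-empty              : E z c ≡ empty
    between-noGhost           : ∀ {y} → z < y → y < t → E y c ≢ ghost
    between-holes-clear-right : ∀ {y} → z < y → y < t → E y c ≡ empty →
                                ∀ {c′} → c < c′ → E y c′ ≡ empty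

-- Move the cell down to the highest hole h below t, then continue from h.
slide-reachable : ∀ {E c z t l} → l ≡ empty ⊎ l ≡ ghost → SlideCondition E c z t →
                  KKD E (slideColumn E c z t l)
slide-reachable {c = c} {z} {t} {l} l-kind = <-rec Reachable reach t
  where
    Reachable : ℕ → Set
    Reachable t = ∀ {E} → SlideCondition E c z t → KKD E (slideColumn E c z t l)

    reach : ∀ t → (∀ {h} → h < t → Reachable h) → Reachable t
    reach t rec {E} cond
      with highestHoleBelow {column E c} (SlideCondition.bottom-empty cond) (SlideCondition.z<t cond)
    ... | h , z≤h , h<t , hole , highest = done (m≤n⇒m<n∨m≡n z≤h)
      where
        open SlideCondition cond
        E₁ = slideColumn E c h t l

        move : KMove E E₁
        move = slide-move l-kind (≤-trans 1≤z z≤h) h<t top-ordinary top-rightmost hole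
                 λ h<y y<t → ≢empty∧≢ghost⇒≡ordinary (highest h<y y<t)
                                                     (between-noGhost (≤-<-trans z≤h h<y) y<t)

        column₁ : ∀ {i} → E₁ i c ≡ slide (column E c) h t l i
        column₁ {i} = slideColumn-same E c i

        below-h : ∀ {y} → y < h → E₁ y c ≡ E y c
        below-h y<h = trans column₁ (slide-below y<h)

        cond₁ : z < h → SlideCondition E₁ c z h
        cond₁ z<h = record
          { 1≤z                       = 1≤z
          ; z<t                       = z<h
          ; top-ordinary              = trans column₁ slide-bottom
          ; top-rightmost             = λ c<c′ →
              trans (slideColumn-other E h (>⇒≢ c<c′)) (between-holes-clear-right z<h h<t hole c<c′)
          ; bottom-empty              = trans (below-h z<h) bottom-empty
          ; between-noGhost           = λ z<y y<h →
              subst (_≢ ghost) (sym (below-h y<h)) (between-noGhost z<y (<-trans y<h h<t))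
          ; between-holes-clear-right = λ z<y y<h e c<c′ →
              trans (slideColumn-other E _ (>⇒≢ c<c′))
                (between-holes-clear-right z<y (<-trans y<h h<t) (trans (sym (below-h y<h)) e) c<c′)
          }

        same-slide : z < h → slideColumn E c z t l ≈D slideColumn E₁ c z h l
        same-slide z<h = ≈D-by-column c
          (λ i → begin
             slideColumn E c z t l i c                 ≡⟨ slideColumn-same E c i ⟩
             slide (column E c) z t l i                ≡⟨ slide-slide z<h h<t hole i ⟨
             slide (slide (column E c) h t l) z h l i  ≡⟨ slide-cong column₁ ⟨
             slide (column E₁ c) z h l i               ≡⟨ slideColumn-same E₁ c i ⟨
             slideColumn E₁ c z h l i c                ∎)
          (λ i j≢c → trans (slideColumn-other E i j≢c)
                       (sym (trans (slideColumn-other E₁ i j≢c) (slideColumn-other E i j≢c))))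
          where open ≡-Reasoning

        done : z < h ⊎ z ≡ h → KKD E (slideColumn E c z t l)
        done (inj₂ refl) = step KKD-refl move
        done (inj₁ z<h)  = KKD-trans (step KKD-refl move) (KKD-respʳ (rec h<t (cond₁ z<h)) (same-slide z<h))

δ : ℕ → ℕ → ℕ
δ z i = boolToℕ ⌊ i ≟ z ⌋

δ-same : ∀ z → δ z z ≡ 1
δ-same z = cong boolToℕ (⌊⌋-true (z ≟ z) refl)

δ-other : ∀ {z i} → i ≢ z → δ z i ≡ 0
δ-other {z} {i} i≢z = cong boolToℕ (⌊⌋-false (i ≟ z) i≢z)

sumTo-δ-≤ : ∀ {z h} → 1 ≤ z → z ≤ h → sumTo h (δ z) ≡ 1
sumTo-δ-≤ {z} {h} 1≤z z≤h = trans (sumTo-single h 1≤z z≤h δ-other) (δ-same z)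

sumTo-δ-> : ∀ {z h} → h < z → sumTo h (δ z) ≡ 0
sumTo-δ-> {h = h} h<z = sumTo-zero h λ _ i≤h → δ-other (<⇒≢ (≤-<-trans i≤h h<z))

-- The Kohnert slide trades the hole at z for a hole at t.
slide-holes : ∀ {u z t} → z < t → u z ≡ empty → u t ≢ empty →
              ∀ h → holes (slide u z t empty) h + sumTo h (δ z) ≡ holes u h + sumTo h (δ t)
slide-holes {u} {z} {t} z<t uz ut h = begin
  holes w h + sumTo h (δ z)                 ≡⟨ sumTo-+ h ⟨
  sumTo h (λ i → #empty (w i) + δ z i)      ≡⟨ sumTo-cong h (λ _ _ → pointwise) ⟩
  sumTo h (λ i → #empty (u i) + δ t i)      ≡⟨ sumTo-+ h ⟩
  holes u h + sumTo h (δ t)                 ∎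
  where
    open ≡-Reasoning
    w = slide u z t empty

    pointwise : ∀ {i} → #empty (w i) + δ z i ≡ #empty (u i) + δ t i
    pointwise {i} = cases (i ≟ z) (i ≟ t)
      where
        cases : Dec (i ≡ z) → Dec (i ≡ t) → #empty (w i) + δ z i ≡ #empty (u i) + δ t i
        cases (yes refl) _ = begin
          #empty (w i) + δ i i  ≡⟨ cong₂ _+_ (cong #empty slide-bottom) (δ-same i) ⟩
          1                     ≡⟨ cong₂ _+_ (#empty-≡1 uz) (δ-other (<⇒≢ z<t)) ⟨
          #empty (u i) + δ t i  ∎
        cases (no i≢z) (yes refl) = begin
          #empty (w i) + δ z i  ≡⟨ cong₂ _+_ (cong #empty (slide-top z<t)) (δ-other i≢z) ⟩
          1                     ≡⟨ cong₂ _+_ (#empty-≡0 ut) (δ-same i) ⟨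
          #empty (u i) + δ i i  ∎
        cases (no i≢z) (no i≢t) =
          cong₂ _+_ (cong #empty (slide-empty-elsewhere i≢z i≢t)) (trans (δ-other i≢z) (sym (δ-other i≢t)))

-- Every hole strictly between z and t becomes a ghost, and the ghost left at t
-- makes up for the hole z that gets filled.
slide-ghosts : ∀ {u z t} → LowestHole u z → z < t → u t ≢ empty →
               holes u t ≤ ghosts (slide u z t ghost) t
slide-ghosts {u} {z} {t} (1≤z , uz , below) z<t ut = +-cancelʳ-≤ 1 _ _ (begin
  holes u t + 1                         ≡⟨ cong (holes u t +_) (sumTo-δ-≤ (≤-trans 1≤z (<⇒≤ z<t)) ≤-refl) ⟨
  holes u t + sumTo t (δ t)             ≡⟨ sumTo-+ t ⟨
  sumTo t (λ i → #empty (u i) + δ t i)  ≤⟨ sumTo-mono t pointwise ⟩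
  sumTo t (λ i → #ghost (w i) + δ z i)  ≡⟨ sumTo-+ t ⟩
  ghosts w t + sumTo t (δ z)            ≡⟨ cong (ghosts w t +_) (sumTo-δ-≤ 1≤z (<⇒≤ z<t)) ⟩
  ghosts w t + 1                        ∎)
  where
    open ≤-Reasoning
    w = slide u z t ghost

    filled : ∀ x → #empty x ≤ #ghost (fillWith ghost x)
    filled empty    = ≤-refl
    filled ordinary = z≤n
    filled ghost    = z≤n

    pointwise : ∀ {i} → 1 ≤ i → i ≤ t → #empty (u i) + δ t i ≤ #ghost (w i) + δ z i
    pointwise {i} 1≤i i≤t = cases (<-cmp i z) (m≤n⇒m<n∨m≡n i≤t)
      where
        cases : Comparison i z → i < t ⊎ i ≡ t → #empty (u i) + δ t i ≤ #ghost (w i) + δ z i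
        cases (tri< i<z _ _) _ = begin
          #empty (u i) + δ t i  ≡⟨ cong₂ _+_ (#empty-≡0 (below 1≤i i<z)) (δ-other (<⇒≢ (<-trans i<z z<t))) ⟩
          0                     ≤⟨ z≤n ⟩
          #ghost (w i) + δ z i  ∎
        cases (tri≈ _ refl _) _ = begin
          #empty (u i) + δ t i  ≡⟨ cong₂ _+_ (#empty-≡1 uz) (δ-other (<⇒≢ z<t)) ⟩
          1                     ≡⟨ cong₂ _+_ (cong #ghost slide-bottom) (δ-same i) ⟨
          #ghost (w i) + δ i i  ∎
        cases (tri> _ _ z<i) (inj₁ i<t) = begin
          #empty (u i) + δ t i                    ≡⟨ cong (#empty (u i) +_) δ-t≡δ-z ⟩
          #empty (u i) + δ z i                    ≤⟨ +-monoˡ-≤ (δ z i) (filled (u i)) ⟩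
          #ghost (fillWith ghost (u i)) + δ z i   ≡⟨ cong (λ x → #ghost x + δ z i) (slide-between z<i i<t) ⟨
          #ghost (w i) + δ z i                    ∎
          where δ-t≡δ-z = trans (δ-other (<⇒≢ i<t)) (sym (δ-other (>⇒≢ z<i)))
        cases (tri> _ _ z<i) (inj₂ refl) = begin
          #empty (u i) + δ i i  ≡⟨ cong₂ _+_ (#empty-≡0 ut) (δ-same i) ⟩
          1                     ≡⟨ cong₂ _+_ (cong #ghost (slide-top z<t)) (δ-other (>⇒≢ z<i)) ⟨
          #ghost (w i) + δ z i  ∎

module _ {u : Column} {z t : ℕ} (1≤z : 1 ≤ z) (z<t : z < t) (uz : u z ≡ empty) (ut : u t ≢ empty) where

  slide-holes-top : holes (slide u z t empty) t ≡ holes u t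
  slide-holes-top = +-cancelʳ-≡ _ _ _ (begin
    holes w t + 1              ≡⟨ cong (holes w t +_) (sumTo-δ-≤ 1≤z (<⇒≤ z<t)) ⟨
    holes w t + sumTo t (δ z)  ≡⟨ slide-holes z<t uz ut t ⟩
    holes u t + sumTo t (δ t)  ≡⟨ cong (holes u t +_) (sumTo-δ-≤ (≤-trans 1≤z (<⇒≤ z<t)) ≤-refl) ⟩
    holes u t + 1              ∎)
    where
      open ≡-Reasoning
      w = slide u z t empty

  slide-holes-below : ∀ {h} → h < t → holes (slide u z t empty) h + sumTo h (δ z) ≡ holes u h
  slide-holes-below {h} h<t =
    trans (slide-holes z<t uz ut h) (trans (cong (holes u h +_) (sumTo-δ-> h<t)) (+-identityʳ _))

data Pushed (t : ℕ) (u w : Column) : Set where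
  kept : u t ≡ empty → (∀ i → w i ≡ u i) → Pushed t u w
  slid : ∀ {z} → u t ≡ ordinary → LowestHole u z → z < t → (∀ i → w i ≡ slide u z t empty i) →
         Pushed t u w

Pushed-resp : ∀ {t u w w′} → Pushed t u w → (∀ i → w′ i ≡ w i) → Pushed t u w′
Pushed-resp (kept ut w≗u)                w′≗w = kept ut λ i → trans (w′≗w i) (w≗u i)
Pushed-resp (slid ut lowest z<t w≗slide) w′≗w = slid ut lowest z<t λ i → trans (w′≗w i) (w≗slide i)

module _ {t : ℕ} {u w : Column} where

  Pushed-top : Pushed t u w → w t ≡ empty
  Pushed-top (kept ut w≗u)          = trans (w≗u t) ut
  Pushed-top (slid _ _ z<t w≗slide) = trans (w≗slide t) (slide-top z<t)

  Pushed-above : ∀ {i} → Pushed t u w → t < i → w i ≡ u i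
  Pushed-above (kept _ w≗u)           t<i = w≗u _
  Pushed-above (slid _ _ z<t w≗slide) t<i = trans (w≗slide _) (slide-above z<t t<i)

  Pushed-below-nonempty : ∀ {i} → Pushed t u w → i < t → u i ≢ empty → w i ≢ empty
  Pushed-below-nonempty {i} (kept _ w≗u) _ ui = subst (_≢ empty) (sym (w≗u i)) ui
  Pushed-below-nonempty {i} (slid {z} _ _ _ w≗slide) i<t ui with i ≟ z
  ... | yes refl = ≡ordinary⇒≢empty (trans (w≗slide i) slide-bottom)
  ... | no  i≢z  = subst (_≢ empty) (sym (trans (w≗slide i) (slide-empty-elsewhere i≢z (<⇒≢ i<t)))) ui

  Pushed-noGhost : ∀ {i} → Pushed t u w → u i ≢ ghost → w i ≢ ghost
  Pushed-noGhost {i} (kept _ w≗u) ui = subst (_≢ ghost) (sym (w≗u i)) ui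
  Pushed-noGhost {i} (slid {z} _ _ z<t w≗slide) ui with i ≟ z | i ≟ t
  ... | yes refl | _        = subst (_≢ ghost) (sym (trans (w≗slide i) slide-bottom)) λ ()
  ... | no _     | yes refl = subst (_≢ ghost) (sym (trans (w≗slide i) (slide-top z<t))) λ ()
  ... | no i≢z   | no i≢t   = subst (_≢ ghost) (sym (trans (w≗slide i) (slide-empty-elsewhere i≢z i≢t))) ui

  Pushed-holes-top : Pushed t u w → holes w t ≡ holes u t
  Pushed-holes-top (kept _ w≗u) = holes-cong t w≗u
  Pushed-holes-top (slid ut (1≤z , uz , _) z<t w≗slide) =
    trans (holes-cong t w≗slide) (slide-holes-top 1≤z z<t uz (≡ordinary⇒≢empty ut))

  Pushed-holes-≤ : ∀ {h} → Pushed t u w → h ≤ t → holes w h ≤ holes u h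
  Pushed-holes-≤ {h} (kept _ w≗u) _ = ≤-reflexive (holes-cong h w≗u)
  Pushed-holes-≤ {h} p@(slid {z} ut (1≤z , uz , _) z<t w≗slide) h≤t with m≤n⇒m<n∨m≡n h≤t
  ... | inj₂ refl = ≤-reflexive (Pushed-holes-top p)
  ... | inj₁ h<t  = begin
    holes w h                                     ≡⟨ holes-cong h w≗slide ⟩
    holes (slide u z t empty) h                   ≤⟨ m≤m+n _ _ ⟩
    holes (slide u z t empty) h + sumTo h (δ z)   ≡⟨ slide-holes-below 1≤z z<t uz (≡ordinary⇒≢empty ut) h<t ⟩
    holes u h                                     ∎
    where open ≤-Reasoning

record FewerHoles (t : ℕ) (u u′ : Column) : Set where
  field
    holes-≤     : ∀ {h} → h ≤ t → holes u h ≤ holes u′ h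
    beside-cell : ∀ {x} → x ≤ t → u x ≡ empty → u′ x ≢ empty →
                  ∀ {y} → 1 ≤ y → y < x → u y ≢ empty

module _ {t : ℕ} {u u′ : Column} (fewer : FewerHoles t u u′) where
  open FewerHoles fewer

  lowestHole′-≤ : ∀ {z z′} → 1 ≤ z → z ≤ t → u z ≡ empty → LowestHole u′ z′ → z′ ≤ z
  lowestHole′-≤ {z} 1≤z z≤t uz lowest′ =
    lowestHole-≤ z lowest′ (≤-trans (hole⇒holes-positive z 1≤z ≤-refl uz) (holes-≤ z≤t))

  -- This keeps the rows of the holes crossed by a slide clear to its right.
  Pushed-keeps-hole : ∀ {w′ z y} → Pushed t u′ w′ → 1 ≤ z → z < y → y < t →
                      u z ≡ empty → u y ≡ empty → w′ y ≡ empty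
  Pushed-keeps-hole {w′} {z} {y} pushed 1≤z z<y y<t uz uy = kept-or-slid pushed
    where
      u′y : u′ y ≡ empty
      u′y = decidable-stable (u′ y ≟C empty) λ u′y≢e → beside-cell (<⇒≤ y<t) uy u′y≢e 1≤z z<y uz

      kept-or-slid : Pushed t u′ w′ → w′ y ≡ empty
      kept-or-slid (kept _ w′≗u′) = trans (w′≗u′ y) u′y
      kept-or-slid (slid {z′} _ lowest′ _ w′≗slide) with y ≟ z′
      ... | yes refl = ⊥-elim (<⇒≱ z<y (lowestHole′-≤ 1≤z (<⇒≤ (<-trans z<y y<t)) uz lowest′))
      ... | no  y≢z′ = trans (w′≗slide y) (trans (slide-empty-elsewhere y≢z′ (<⇒≢ y<t)) u′y)

  Pushed-FewerHoles : ∀ {w w′} → (u′ t ≢ empty → u t ≢ empty) → Pushed t u w → Pushed t u′ w′ →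
                      FewerHoles t w w′
  Pushed-FewerHoles {w} {w′} cell-left pushed pushed′ =
    record { holes-≤ = holes-≤′ pushed pushed′ ; beside-cell = beside-cell′ }
    where
      holes-≤′ : Pushed t u w → Pushed t u′ w′ → ∀ {h} → h ≤ t → holes w h ≤ holes w′ h
      holes-≤′ (kept ut _) (slid u′t _ _ _) _ = ⊥-elim (cell-left (≡ordinary⇒≢empty u′t) ut)
      holes-≤′ p (kept _ w′≗u′) {h} h≤t = begin
        holes w h   ≤⟨ Pushed-holes-≤ p h≤t ⟩
        holes u h   ≤⟨ holes-≤ h≤t ⟩
        holes u′ h  ≡⟨ holes-cong h w′≗u′ ⟨
        holes w′ h  ∎
        where open ≤-Reasoning
      holes-≤′ p@(slid {z} ut lowest@(1≤z , uz , _) z<t w≗slide)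
               p′@(slid {z′} u′t lowest′@(1≤z′ , u′z′ , _) z′<t w′≗slide′) {h} h≤t
        with m≤n⇒m<n∨m≡n h≤t
      ... | inj₂ refl = begin
        holes w h   ≡⟨ Pushed-holes-top p ⟩
        holes u h   ≤⟨ holes-≤ ≤-refl ⟩
        holes u′ h  ≡⟨ Pushed-holes-top p′ ⟨
        holes w′ h  ∎
        where open ≤-Reasoning
      ... | inj₁ h<t with h <? z
      ...   | yes h<z = begin
        holes w h   ≤⟨ Pushed-holes-≤ p h≤t ⟩
        holes u h   ≤⟨ ≮⇒≥ (λ 1≤holes → <⇒≱ h<z (lowestHole-≤ h lowest 1≤holes)) ⟩
        0           ≤⟨ z≤n ⟩
        holes w′ h  ∎
        where open ≤-Reasoning
      ...   | no  h≮z = +-cancelʳ-≤ 1 _ _ (begin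
        holes w h + 1
          ≡⟨ cong₂ _+_ (holes-cong h w≗slide) (sym (sumTo-δ-≤ 1≤z z≤h)) ⟩
        holes (slide u z t empty) h + sumTo h (δ z)
          ≡⟨ slide-holes-below 1≤z z<t uz (≡ordinary⇒≢empty ut) h<t ⟩
        holes u h
          ≤⟨ holes-≤ h≤t ⟩
        holes u′ h
          ≡⟨ slide-holes-below 1≤z′ z′<t u′z′ (≡ordinary⇒≢empty u′t) h<t ⟨
        holes (slide u′ z′ t empty) h + sumTo h (δ z′)
          ≡⟨ cong₂ _+_ (holes-cong h w′≗slide′) (sym (sumTo-δ-≤ 1≤z′ z′≤h)) ⟨
        holes w′ h + 1
          ∎)
        where
          open ≤-Reasoning
          z≤h  = ≮⇒≥ h≮z
          z′≤h = ≤-trans (lowestHole′-≤ 1≤z (<⇒≤ z<t) uz lowest′) z≤h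

      beside-cell′ : ∀ {x} → x ≤ t → w x ≡ empty → w′ x ≢ empty →
                     ∀ {y} → 1 ≤ y → y < x → w y ≢ empty
      beside-cell′ {x} x≤t wx w′x {y} 1≤y y<x = Pushed-below-nonempty pushed y<t (beside pushed′)
        where
          x<t : x < t
          x<t = ≤∧≢⇒< x≤t λ { refl → w′x (Pushed-top pushed′) }
          y<t = <-trans y<x x<t

          ux : u x ≡ empty
          ux = decidable-stable (u x ≟C empty) λ ux≢e → Pushed-below-nonempty pushed x<t ux≢e wx

          beside : Pushed t u′ w′ → u y ≢ empty
          beside (kept _ w′≗u′) = beside-cell x≤t ux (λ u′x → w′x (trans (w′≗u′ x) u′x)) 1≤y y<x
          beside (slid {z′} _ lowest′ _ w′≗slide′) with x ≟ z′
          ... | yes refl = λ uy → <⇒≱ y<x (lowestHole′-≤ 1≤y (<⇒≤ y<t) uy lowest′)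
          ... | no  x≢z′ = beside-cell x≤t ux u′x 1≤y y<x
            where
              u′x : u′ x ≢ empty
              u′x = subst (_≢ empty) (trans (w′≗slide′ x) (slide-empty-elsewhere x≢z′ (<⇒≢ x<t))) w′x

module SkewRows {n : ℕ} {D : Diagram} (bounded : Bounded n D) (skew : GeneralizedSkew D) where
  open GeneralizedSkew skew

  nonempty⇒ordinary : ∀ {x c} → D x c ≢ empty → D x c ≡ ordinary
  nonempty⇒ordinary ne = ≢empty∧≢ghost⇒≡ordinary ne (ghostFree _ _)

  leftmost : ∀ {x c} → D x c ≢ empty → ∃[ a ] a ≤ c × IsLeftmost D x a
  leftmost {x} ne with least (λ m → ¬? (D x m ≟C empty)) ne
  ... | a , a≤c , cell , none-left =
    a , a≤c , nonempty⇒ordinary cell , λ c′ c′<a → decidable-stable (D x c′ ≟C empty) (none-left c′<a)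

  rightmost : ∀ {x c} → D x c ≢ empty → ∃[ b ] c ≤ b × IsRightmost D x b
  rightmost {x} ne
    with greatest (λ m → ¬? (D x m ≟C empty)) n (λ n<j cell → <⇒≱ n<j (proj₂ (proj₂ (bounded x _ cell)))) ne
  ... | b , c≤b , cell , none-right =
    b , c≤b , nonempty⇒ordinary cell , λ c′ b<c′ → decidable-stable (D x c′ ≟C empty) (none-right b<c′)

  leftmost-≤ : ∀ {x a c} → IsLeftmost D x a → D x c ≢ empty → a ≤ c
  leftmost-≤ (_ , none-left) cell = ≮⇒≥ λ c<a → cell (none-left _ c<a)

  row-filled : ∀ {x a b c} → D x a ≢ empty → D x b ≢ empty → a ≤ c → c ≤ b → D x c ≡ ordinary
  row-filled {x} {a} {b} {c} cell-a cell-b a≤c c≤b with leftmost cell-a | rightmost cell-b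
  ... | a₀ , a₀≤a , left | b₀ , b≤b₀ , right
      with m≤n⇒m<n∨m≡n (≤-trans a₀≤a a≤c) | m≤n⇒m<n∨m≡n (≤-trans c≤b b≤b₀)
  ...   | inj₂ refl | _         = proj₁ left
  ...   | inj₁ _    | inj₂ refl = proj₁ right
  ...   | inj₁ a₀<c | inj₁ c<b₀ = contiguous x a₀ b₀ c left right a₀<c c<b₀

  filled-left-below : ∀ {t B x c c′} → D t B ≡ ordinary → x ≤ t → B ≤ c → c < c′ →
                      D x c′ ≢ empty → D x c ≢ empty
  filled-left-below {t} {B} {x} cell-tB x≤t B≤c c<c′ cell-xc′ with leftmost cell-xc′
  ... | a , _ , left =
    ≡ordinary⇒≢empty (row-filled (≡ordinary⇒≢empty (proj₁ left)) cell-xc′ (≤-trans a≤B B≤c) (<⇒≤ c<c′))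
    where
      a≤B : a ≤ B
      a≤B with m≤n⇒m<n∨m≡n x≤t
      ... | inj₂ refl = leftmost-≤ left (≡ordinary⇒≢empty cell-tB)
      ... | inj₁ x<t with leftmost (≡ordinary⇒≢empty cell-tB)
      ...   | a′ , a′≤B , left′ = ≤-trans (leftMono x t a a′ x<t left left′) a′≤B

  extends-right-above : ∀ {x t c c′} → x < t → D x c′ ≡ ordinary → D t c ≡ ordinary → c < c′ →
                        D t c′ ≡ ordinary
  extends-right-above {x} {t} x<t cell-xc′ cell-tc c<c′
    with rightmost (≡ordinary⇒≢empty cell-xc′) | rightmost (≡ordinary⇒≢empty cell-tc)
  ... | b , c′≤b , right | b′ , _ , right′ =
    row-filled (≡ordinary⇒≢empty cell-tc) (≡ordinary⇒≢empty (proj₁ right′)) (<⇒≤ c<c′)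
               (≤-trans c′≤b (rightMono x t b b′ x<t right right′))

-- The dark clouds form a chain going down and to the left

data CloudChain (n : ℕ) (D : Diagram) : ℕ → ℕ → List (ℕ × ℕ) → Set where
  []   : CloudChain n D 0 0 []
  cons : ∀ {t₀ B₀ t B L} → t₀ < t → B₀ < B → D t B ≡ ordinary → t ≤ n → B ≤ n →
         CloudChain n D t₀ B₀ L → CloudChain n D t B ((t , B) ∷ L)

CloudChain-head≤ : ∀ {n D t B L} → CloudChain n D t B L → B ≤ n
CloudChain-head≤ []                        = z≤n
CloudChain-head≤ (cons _ _ _ _ B≤n _)      = B≤n

rightmostSat-just : ∀ {k p c} → rightmostSat k p ≡ just c →
                    p c ≡ true × 1 ≤ c × c ≤ k × (∀ {c′} → c < c′ → c′ ≤ k → p c′ ≡ false)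
rightmostSat-just {zero} ()
rightmostSat-just {suc k} {p} found with p (suc k) in p[1+k]
rightmostSat-just {suc k} {p} refl | true =
  p[1+k] , s≤s z≤n , ≤-refl , λ k<c′ c′≤k → ⊥-elim (<⇒≱ k<c′ c′≤k)
rightmostSat-just {suc k} {p} found | false with rightmostSat-just found
... | pc , 1≤c , c≤k , none-right = pc , 1≤c , m≤n⇒m≤1+n c≤k , none-right′
  where
    none-right′ : ∀ {c′} → _ < c′ → c′ ≤ suc k → p c′ ≡ false
    none-right′ c<c′ c′≤1+k with m≤n⇒m<n∨m≡n c′≤1+k
    ... | inj₁ c′<1+k = none-right c<c′ (m<1+n⇒m≤n c′<1+k)
    ... | inj₂ refl   = p[1+k]

memℕ-∷ : ∀ {x y} ys → memℕ x (y ∷ ys) ≡ false → x ≢ y × memℕ x ys ≡ false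
memℕ-∷ {x} {y} _ not-member with x ≟ y
... | no x≢y = x≢y , not-member

unmarked-ordinary : ∀ {x b} → isOrdinary x ∧ not b ≡ true → x ≡ ordinary × b ≡ false
unmarked-ordinary {ordinary} {false} _ = refl , refl

module DarkClouds {n : ℕ} {D : Diagram} (bounded : Bounded n D) (skew : GeneralizedSkew D) where
  open SkewRows bounded skew

  HeadUnmarked : List ℕ → List (ℕ × ℕ) → Set
  HeadUnmarked marked []              = ⊤
  HeadUnmarked marked ((_ , B) ∷ _)   = memℕ B marked ≡ false

  cloudsAux-chain : ∀ k marked → k ≤ n →
    ∃[ t ] ∃[ B ] CloudChain n D t B (cloudsAux n D k marked) × t ≤ k ×
                  HeadUnmarked marked (cloudsAux n D k marked)
  cloudsAux-chain zero marked _ = 0 , 0 , [] , z≤n , tt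
  cloudsAux-chain (suc k) marked 1+k≤n
    with rightmostSat n (λ c → isOrdinary (D (suc k) c) ∧ not (memℕ c marked)) in found
  ... | nothing with cloudsAux-chain k marked (≤-trans (n≤1+n k) 1+k≤n)
  ...   | t , B , chain , t≤k , unmarked = t , B , chain , m≤n⇒m≤1+n t≤k , unmarked
  cloudsAux-chain (suc k) marked 1+k≤n | just c
    with rightmostSat-just found | cloudsAux-chain k (c ∷ marked) (≤-trans (n≤1+n k) 1+k≤n)
  ... | candidate , 1≤c , c≤n , none-right | t , B , chain , t≤k , unmarked =
    suc k , c , cons (s≤s t≤k) (B<c chain t≤k unmarked) ordinary-c 1+k≤n c≤n chain , ≤-refl , unmarked-c
    where
      ordinary-c = proj₁ (unmarked-ordinary candidate)
      unmarked-c = proj₂ (unmarked-ordinary candidate)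

      -- A column right of c holding a cell lower down would, by skewness, hold an unmarked cell in row 1+k.
      B<c : ∀ {t B L} → CloudChain n D t B L → t ≤ k → HeadUnmarked (c ∷ marked) L → B < c
      B<c [] _ _ = 1≤c
      B<c {t} {B} (cons _ _ ordinary-tB _ B≤n _) t≤k unmarked-B with memℕ-∷ marked unmarked-B | <-cmp B c
      ... | _   , _           | tri< B<c _ _ = B<c
      ... | B≢c , _           | tri≈ _ B≡c _ = ⊥-elim (B≢c B≡c)
      ... | _   , unmarked-B′ | tri> _ _ c<B = ⊥-elim (true≢false (begin
        true
          ≡⟨ cong₂ (λ x b → isOrdinary x ∧ not b) ordinary-B unmarked-B′ ⟨
        isOrdinary (D (suc k) B) ∧ not (memℕ B marked)
          ≡⟨ none-right c<B B≤n ⟩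
        false
          ∎))
        where
          open ≡-Reasoning
          ordinary-B = extends-right-above (s≤s t≤k) ordinary-tB ordinary-c c<B
          true≢false : true ≢ false
          true≢false ()

-- Ghosting the columns of the dark clouds, from the lowest cloud up

downward-induction : (P : ℕ → Set) → ∀ {a b} → a ≤ b → P b →
                     (∀ {m} → a ≤ m → m < b → P (suc m) → P m) → P a
downward-induction P {b = zero}  a≤0   pb _ rewrite n≤0⇒n≡0 a≤0 = pb
downward-induction P {b = suc b} a≤1+b pb down with m≤n⇒m<n∨m≡n a≤1+b
... | inj₂ refl  = pb
... | inj₁ a<1+b =
  downward-induction P a≤b (down a≤b ≤-refl pb) λ a≤m m<b → down a≤m (m<n⇒m<1+n m<b)
  where a≤b = m<1+n⇒m≤n a<1+b

cloudHoles : Diagram → ℕ × ℕ → ℕ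
cloudHoles D (t , B) = holes (column D B) t

columnGhosts : ℕ → Diagram → ℕ → ℕ
columnGhosts n F c = ghosts (column F c) n

module Ghosting {n : ℕ} {D : Diagram} (bounded : Bounded n D) (skew : GeneralizedSkew D) where
  open GeneralizedSkew skew
  open SkewRows bounded skew

  -- The state once every cloud up to (t₀ , B₀) has been ghosted.
  record Invariant (t₀ B₀ : ℕ) (S : Diagram) : Set where
    field
      unchanged-above : ∀ {i} j → t₀ < i → S i j ≡ D i j
      noGhost-right   : ∀ i {j} → B₀ < j → S i j ≢ ghost
      holes-preserved : ∀ {j} → B₀ < j → holes (column S j) t₀ ≡ holes (column D j) t₀
      fewerHoles      : ∀ {c c′} → B₀ < c → c < c′ → FewerHoles t₀ (column S c) (column S c′)

  invariant₀ : Invariant 0 0 D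
  invariant₀ = record
    { unchanged-above = λ _ _ → refl
    ; noGhost-right   = λ i _ → ghostFree i _
    ; holes-preserved = λ _ → refl
    ; fewerHoles      = λ _ _ → record
                          { holes-≤ = λ { z≤n → ≤-refl } ; beside-cell = λ { z≤n _ _ _ () } }
    }

  module Step {t₀ B₀ t B : ℕ} {S : Diagram} (inv : Invariant t₀ B₀ S) (t₀<t : t₀ < t) (B₀<B : B₀ < B)
              (cloud : D t B ≡ ordinary) (t≤n : t ≤ n) (B≤n : B ≤ n) where
    open Invariant inv

    holes-extended : ∀ {j h} → B₀ < j → t₀ ≤ h → holes (column S j) h ≡ holes (column D j) h
    holes-extended {j} {h} B₀<j =
      sumTo-extend h (holes-preserved B₀<j) λ t₀<i _ → cong #empty (unchanged-above j t₀<i)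

    fewerHoles-extended : ∀ {c c′} → B ≤ c → c < c′ → FewerHoles t (column S c) (column S c′)
    fewerHoles-extended {c} {c′} B≤c c<c′ = record { holes-≤ = holes-≤′ ; beside-cell = beside-cell′ }
      where
        B₀<c = <-≤-trans B₀<B B≤c
        open FewerHoles (fewerHoles B₀<c c<c′)

        holes-≤′ : ∀ {h} → h ≤ t → holes (column S c) h ≤ holes (column S c′) h
        holes-≤′ {h} h≤t with h ≤? t₀
        ... | yes h≤t₀ = holes-≤ h≤t₀
        ... | no  h≰t₀ = begin
          holes (column S c) h   ≡⟨ holes-extended B₀<c t₀≤h ⟩
          holes (column D c) h   ≤⟨ holes-mono h (λ _ y≤h → filled-left-below cloud (≤-trans y≤h h≤t) B≤c c<c′) ⟩
          holes (column D c′) h  ≡⟨ holes-extended (<-trans B₀<c c<c′) t₀≤h ⟨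
          holes (column S c′) h  ∎
          where
            open ≤-Reasoning
            t₀≤h = <⇒≤ (≰⇒> h≰t₀)

        beside-cell′ : ∀ {x} → x ≤ t → S x c ≡ empty → S x c′ ≢ empty →
                       ∀ {y} → 1 ≤ y → y < x → S y c ≢ empty
        beside-cell′ {x} x≤t Sxc Sxc′ with x ≤? t₀
        ... | yes x≤t₀ = beside-cell x≤t₀ Sxc Sxc′
        ... | no  x≰t₀ = ⊥-elim (filled-left-below cloud x≤t B≤c c<c′ Dxc′ Dxc)
          where
            t₀<x = ≰⇒> x≰t₀
            Dxc′ = subst (_≢ empty) (unchanged-above c′ t₀<x) Sxc′
            Dxc  = trans (sym (unchanged-above c t₀<x)) Sxc

    StB : S t B ≡ ordinary
    StB = trans (unchanged-above B t₀<t) cloud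

    top-cell-left : ∀ {c c′} → B ≤ c → c < c′ → S t c′ ≢ empty → S t c ≢ empty
    top-cell-left {c} {c′} B≤c c<c′ Stc′ Stc = filled-left-below cloud ≤-refl B≤c c<c′
      (subst (_≢ empty) (unchanged-above c′ t₀<t) Stc′) (trans (sym (unchanged-above c t₀<t)) Stc)

    Outcome : Set
    Outcome = ∃[ F ] KKD S F × Invariant t B F × (∀ i {j} → j < B → F i j ≡ S i j) ×
                     cloudHoles D (t , B) ≤ columnGhosts n F B

    no-holes : holes (column S B) t ≡ 0 → Outcome
    no-holes none = S , KKD-refl , inv′ , (λ _ _ → refl) , none-in-D
      where
        none-in-D : holes (column D B) t ≤ columnGhosts n S B
        none-in-D = ≤-trans (≤-reflexive (trans (sym (holes-extended B₀<B (<⇒≤ t₀<t))) none)) z≤n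

        inv′ : Invariant t B S
        inv′ = record
          { unchanged-above = λ j t<i → unchanged-above j (<-trans t₀<t t<i)
          ; noGhost-right   = λ i B<j → noGhost-right i (<-trans B₀<B B<j)
          ; holes-preserved = λ B<j → holes-extended (<-trans B₀<B B<j) (<⇒≤ t₀<t)
          ; fewerHoles      = λ B<c → fewerHoles-extended (<⇒≤ B<c)
          }

    module WithHoles (hole : 1 ≤ holes (column S B) t) where

      holes-right : ∀ {j} → B ≤ j → 1 ≤ holes (column S j) t
      holes-right B≤j with m≤n⇒m<n∨m≡n B≤j
      ... | inj₂ refl = hole
      ... | inj₁ B<j  = ≤-trans hole (FewerHoles.holes-≤ (fewerHoles-extended ≤-refl B<j) ≤-refl)

      lowestHole-below-cell : ∀ {j} → B ≤ j → S t j ≡ ordinary →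
                              ∃[ z ] LowestHole (column S j) z × z < t
      lowestHole-below-cell B≤j Stj with lowestHole t (holes-right B≤j)
      ... | z , z≤t , lowest@(_ , Szj , _) =
        z , lowest , ≤∧≢⇒< z≤t λ { refl → ≡ordinary⇒≢empty Stj Szj }

      slideCondition : ∀ {T j z} → B ≤ j → (∀ {c′} → j < c′ → Pushed t (column S c′) (column T c′)) →
                       (∀ i → T i j ≡ S i j) → S t j ≡ ordinary → LowestHole (column S j) z → z < t →
                       SlideCondition T j z t
      slideCondition {T} {j} {z} B≤j pushed same Stj (1≤z , Szj , _) z<t = record
        { 1≤z                       = 1≤z
        ; z<t                       = z<t
        ; top-ordinary              = trans (same t) Stj
        ; top-rightmost             = λ j<c′ → Pushed-top (pushed j<c′)
        ; bottom-empty              = trans (same z) Szj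
        ; between-noGhost           = λ {y} _ _ →
            subst (_≢ ghost) (sym (same y)) (noGhost-right y (<-≤-trans B₀<B B≤j))
        ; between-holes-clear-right = λ {y} z<y y<t Tyj j<c′ →
            Pushed-keeps-hole (fewerHoles-extended B≤j j<c′) (pushed j<c′) 1≤z z<y y<t Szj
                              (trans (sym (same y)) Tyj)
        }

      Pushes : ℕ → Diagram → Set
      Pushes m T = KKD S T × (∀ {j} → m < j → Pushed t (column S j) (column T j)) ×
                   (∀ i {j} → j ≤ m → T i j ≡ S i j)

      push-nothing : Pushes n S
      push-nothing = KKD-refl , (λ n<j → kept (outside n<j) λ _ → refl) , λ _ _ → refl
        where
          outside : ∀ {j} → n < j → S t j ≡ empty
          outside {j} n<j = trans (unchanged-above j t₀<t)
            (decidable-stable (D t j ≟C empty) λ Dtj → <⇒≱ n<j (proj₂ (proj₂ (bounded t j Dtj))))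

      push-column : ∀ {m} → B ≤ m → ∃ (Pushes (suc m)) → ∃ (Pushes m)
      push-column {m} B≤m (T , reach , pushed , same) with S t (suc m) ≟C ordinary
      ... | no Stj≢o = T , reach , pushed′ , λ i j≤m → same i (m≤n⇒m≤1+n j≤m)
        where
          Stj : S t (suc m) ≡ empty
          Stj = decidable-stable (S t (suc m) ≟C empty) λ Stj≢e → Stj≢o (≢empty∧≢ghost⇒≡ordinary Stj≢e
                  (noGhost-right t (<-≤-trans B₀<B (m≤n⇒m≤1+n B≤m))))
          pushed′ : ∀ {j} → m < j → Pushed t (column S j) (column T j)
          pushed′ m<j with m≤n⇒m<n∨m≡n m<j
          ... | inj₁ 1+m<j = pushed 1+m<j
          ... | inj₂ refl  = kept Stj λ i → same i ≤-refl
      ... | yes Stj with lowestHole-below-cell (m≤n⇒m≤1+n B≤m) Stj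
      ...   | z , lowest , z<t =
        T′ , KKD-trans reach (slide-reachable (inj₁ refl) condition) , pushed′ , same′
        where
          condition = slideCondition (m≤n⇒m≤1+n B≤m) pushed (λ i → same i ≤-refl) Stj lowest z<t
          T′ = slideColumn T (suc m) z t empty
          pushed′ : ∀ {j} → m < j → Pushed t (column S j) (column T′ j)
          pushed′ m<j with m≤n⇒m<n∨m≡n m<j
          ... | inj₁ 1+m<j = Pushed-resp (pushed 1+m<j) λ i → slideColumn-other T i (>⇒≢ 1+m<j)
          ... | inj₂ refl  = slid Stj lowest z<t λ i →
            trans (slideColumn-same T (suc m) i) (slide-cong (same i ≤-refl))
          same′ : ∀ i {j} → j ≤ m → T′ i j ≡ S i j
          same′ i j≤m = trans (slideColumn-other T i (<⇒≢ (s≤s j≤m))) (same i (m≤n⇒m≤1+n j≤m))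

      outcome : Outcome
      outcome with downward-induction (λ m → ∃ (Pushes m)) B≤n (S , push-nothing) (λ B≤m _ → push-column B≤m)
                 | lowestHole-below-cell ≤-refl StB
      ... | P , reach , pushed , same | z , lowest , z<t =
        F , KKD-trans reach (slide-reachable (inj₂ refl) condition) , inv′ , unchanged-left , ghosts-B
        where
          condition = slideCondition ≤-refl pushed (λ i → same i ≤-refl) StB lowest z<t
          F = slideColumn P B z t ghost

          column-B : ∀ i → F i B ≡ slide (column S B) z t ghost i
          column-B i = trans (slideColumn-same P B i) (slide-cong (same i ≤-refl))

          pushedF : ∀ {j} → B < j → Pushed t (column S j) (column F j)
          pushedF B<j = Pushed-resp (pushed B<j) λ i → slideColumn-other P i (>⇒≢ B<j)

          unchanged-left : ∀ i {j} → j < B → F i j ≡ S i j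
          unchanged-left i j<B = trans (slideColumn-other P i (<⇒≢ j<B)) (same i (<⇒≤ j<B))

          unchanged-above′ : ∀ {i} j → t < i → F i j ≡ D i j
          unchanged-above′ {i} j t<i = trans (by-column (<-cmp j B)) (unchanged-above j (<-trans t₀<t t<i))
            where
              by-column : Comparison j B → F i j ≡ S i j
              by-column (tri< j<B _ _)  = unchanged-left i j<B
              by-column (tri≈ _ refl _) = trans (column-B i) (slide-above z<t t<i)
              by-column (tri> _ _ B<j)  = Pushed-above (pushedF B<j) t<i

          inv′ : Invariant t B F
          inv′ = record
            { unchanged-above = unchanged-above′
            ; noGhost-right   = λ i B<j → Pushed-noGhost (pushedF B<j) (noGhost-right i (<-trans B₀<B B<j))
            ; holes-preserved = λ B<j →
                trans (Pushed-holes-top (pushedF B<j)) (holes-extended (<-trans B₀<B B<j) (<⇒≤ t₀<t))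
            ; fewerHoles      = λ B<c c<c′ → Pushed-FewerHoles (fewerHoles-extended (<⇒≤ B<c) c<c′)
                                   (top-cell-left (<⇒≤ B<c) c<c′) (pushedF B<c) (pushedF (<-trans B<c c<c′))
            }

          ghosts-B : cloudHoles D (t , B) ≤ columnGhosts n F B
          ghosts-B = begin
            holes (column D B) t                     ≡⟨ holes-extended B₀<B (<⇒≤ t₀<t) ⟨
            holes (column S B) t                     ≤⟨ slide-ghosts lowest z<t (≡ordinary⇒≢empty StB) ⟩
            ghosts (slide (column S B) z t ghost) t  ≡⟨ sumTo-cong t (λ {i} _ _ → cong #ghost (sym (column-B i))) ⟩
            ghosts (column F B) t                    ≤⟨ sumTo-≤-bound t≤n ⟩
            ghosts (column F B) n                    ∎
            where open ≤-Reasoning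

    outcome : Outcome
    outcome with holes (column S B) t ≟ 0
    ... | yes none = no-holes none
    ... | no  some = WithHoles.outcome (n≢0⇒n>0 some)

  ghost-clouds : ∀ {t B L} → CloudChain n D t B L →
                 ∃[ F ] KKD D F × Invariant t B F × sum (map (cloudHoles D) L) ≤ sumTo B (columnGhosts n F)
  ghost-clouds [] = D , KKD-refl , invariant₀ , z≤n
  ghost-clouds (cons {B₀ = B₀} {t} {suc B′} {L} t₀<t B₀<B@(s≤s B₀≤B′) cloud t≤n B≤n chain)
    with ghost-clouds chain
  ... | F′ , reach′ , inv′ , bound′ with Step.outcome inv′ t₀<t B₀<B cloud t≤n B≤n
  ...   | F , reach , inv , unchanged-left , ghosts-B = F , KKD-trans reach′ reach , inv , (begin
    cloudHoles D (t , suc B′) + sum (map (cloudHoles D) L)  ≤⟨ +-mono-≤ ghosts-B bound′ ⟩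
    ghosts-B′ + sumTo B₀ (columnGhosts n F′)                ≡⟨ cong (ghosts-B′ +_) (sumTo-cong B₀ same-left) ⟨
    ghosts-B′ + sumTo B₀ (columnGhosts n F)                 ≤⟨ +-monoʳ-≤ ghosts-B′ (sumTo-≤-bound B₀≤B′) ⟩
    ghosts-B′ + sumTo B′ (columnGhosts n F)                 ≡⟨ +-comm ghosts-B′ _ ⟩
    sumTo (suc B′) (columnGhosts n F)                       ∎)
    where
      open ≤-Reasoning
      ghosts-B′ = columnGhosts n F (suc B′)
      same-left : ∀ {c} → 1 ≤ c → c ≤ B₀ → columnGhosts n F c ≡ columnGhosts n F′ c
      same-left _ c≤B₀ = ghosts-cong n λ i → unchanged-left i (s≤s (≤-trans c≤B₀ B₀≤B′))

-- Snowflakes lie in the columns of the dark clouds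

count-∧-any : ∀ {A : Set} b (f : A → Bool) L →
              boolToℕ (b ∧ any f L) ≤ sum (map (λ x → boolToℕ (b ∧ f x)) L)
count-∧-any false f L       = z≤n
count-∧-any true  f []      = z≤n
count-∧-any true  f (x ∷ L) with f x
... | true  = s≤s z≤n
... | false = count-∧-any true f L

sumTo-sum-map : ∀ {A : Set} n (L : List A) (g : ℕ → A → ℕ) →
                sumTo n (λ i → sum (map (g i) L)) ≡ sum (map (λ x → sumTo n (λ i → g i x)) L)
sumTo-sum-map n []      g = sumTo-zero n λ _ _ → refl
sumTo-sum-map n (x ∷ L) g = trans (sumTo-+ n) (cong (sumTo n (λ i → g i x) +_) (sumTo-sum-map n L g))

module Snowflakes (n : ℕ) (D : Diagram) where

  -- The term that a single cloud contributes to cloudAbove n D r c in sf n D.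
  snowBelow : ℕ → ℕ → ℕ × ℕ → ℕ
  snowBelow r c (t , B) = boolToℕ (isEmpty (D r c) ∧ (⌊ c ≟ B ⌋ ∧ ⌊ suc r ≤? t ⌋))

  snowBelow-cloud : ∀ {t B} → D t B ≡ ordinary → t ≤ n → 1 ≤ B → B ≤ n →
                    sumTo n (λ r → sumTo n (λ c → snowBelow r c (t , B))) ≡ cloudHoles D (t , B)
  snowBelow-cloud {t} {B} cloud t≤n 1≤B B≤n =
    trans (sumTo-cong n λ {r} _ _ → in-column r) (sumTo-restrict n t≤n up-to-t above-t)
    where
      emptyBelow : ℕ → ℕ
      emptyBelow r = boolToℕ (isEmpty (D r B) ∧ ⌊ suc r ≤? t ⌋)

      in-column : ∀ r → sumTo n (λ c → snowBelow r c (t , B)) ≡ emptyBelow r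
      in-column r = trans (sumTo-single n 1≤B B≤n off-B) on-B
        where
          off-B : ∀ {c} → c ≢ B → snowBelow r c (t , B) ≡ 0
          off-B {c} c≢B = cong boolToℕ (begin
            isEmpty (D r c) ∧ (⌊ c ≟ B ⌋ ∧ ⌊ suc r ≤? t ⌋)
              ≡⟨ cong (λ b → isEmpty (D r c) ∧ (b ∧ _)) (⌊⌋-false (c ≟ B) c≢B) ⟩
            isEmpty (D r c) ∧ false
              ≡⟨ ∧-zeroʳ _ ⟩
            false
              ∎)
            where open ≡-Reasoning
          on-B : snowBelow r B (t , B) ≡ emptyBelow r
          on-B = cong (λ b → boolToℕ (isEmpty (D r B) ∧ (b ∧ ⌊ suc r ≤? t ⌋))) (⌊⌋-true (B ≟ B) refl)

      up-to-t : ∀ {r} → r ≤ t → emptyBelow r ≡ #empty (D r B)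
      up-to-t {r} r≤t with m≤n⇒m<n∨m≡n r≤t
      ... | inj₁ r<t  =
        cong boolToℕ (trans (cong (isEmpty (D r B) ∧_) (⌊⌋-true (suc r ≤? t) r<t)) (∧-identityʳ _))
      ... | inj₂ refl =
        trans (cong (λ x → boolToℕ (isEmpty x ∧ ⌊ suc r ≤? r ⌋)) cloud) (sym (cong #empty cloud))

      above-t : ∀ {r} → t < r → emptyBelow r ≡ 0
      above-t {r} t<r =
        cong boolToℕ (trans (cong (isEmpty (D r B) ∧_) (⌊⌋-false (suc r ≤? t) (<⇒≱ t<r ∘ <⇒≤))) (∧-zeroʳ _))

  snowBelow-chain : ∀ {t B L} → CloudChain n D t B L →
                    sum (map (λ x → sumTo n (λ r → sumTo n (λ c → snowBelow r c x))) L) ≡ sum (map (cloudHoles D) L)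
  snowBelow-chain []                                   = refl
  snowBelow-chain (cons _ (s≤s _) cloud t≤n B≤n chain) =
    cong₂ _+_ (snowBelow-cloud cloud t≤n (s≤s z≤n) B≤n) (snowBelow-chain chain)

  sf-≤ : ∀ {t B} → CloudChain n D t B (darkClouds n D) → sf n D ≤ sum (map (cloudHoles D) (darkClouds n D))
  sf-≤ chain = begin
    sf n D
      ≤⟨ sumTo-mono n (λ {r} _ _ → sumTo-mono n λ {c} _ _ → count-∧-any (isEmpty (D r c)) _ clouds) ⟩
    sumTo n (λ r → sumTo n (λ c → sum (map (snowBelow r c) clouds)))
      ≡⟨ sumTo-cong n (λ {r} _ _ → sumTo-sum-map n clouds (snowBelow r)) ⟩
    sumTo n (λ r → sum (map (λ x → sumTo n (λ c → snowBelow r c x)) clouds))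
      ≡⟨ sumTo-sum-map n clouds _ ⟩
    sum (map (λ x → sumTo n (λ r → sumTo n (λ c → snowBelow r c x))) clouds)
      ≡⟨ snowBelow-chain chain ⟩
    sum (map (cloudHoles D) clouds)
      ∎
    where
      open ≤-Reasoning
      clouds = darkClouds n D

proposition3p8 : (n : ℕ) (D : Diagram) → Bounded n D → GeneralizedSkew D →
    Σ Diagram (λ D' → KKD D D' × sf n D ≤ ghostCount n D')
proposition3p8 n D bounded skew with DarkClouds.cloudsAux-chain bounded skew n [] ≤-refl
... | t , B , chain , _ with Ghosting.ghost-clouds bounded skew chain
...   | F , reach , _ , bound = F , reach , (begin
  sf n D                                     ≤⟨ Snowflakes.sf-≤ n D chain ⟩
  sum (map (cloudHoles D) (darkClouds n D))  ≤⟨ bound ⟩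
  sumTo B (columnGhosts n F)                 ≤⟨ sumTo-≤-bound (CloudChain-head≤ chain) ⟩
  sumTo n (columnGhosts n F)                 ≡⟨ sumTo-swap n n ⟨
  ghostCount n F                             ∎)
  where open ≤-Reasoning
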